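{- Let $G$ be a finite group. Then the matching number of the power graph $P(G)$ equals the matching number of the enhanced power graph $P_e(G)$.
   Context: For a finite group $G$, the power graph $P(G)$ is the simple undirected graph with vertex set $G$ in which distinct $x,y$ are adjacent iff one is a power of the other. The enhanced power graph $P_e(G)$ has vertex set $G$, with distinct $x,y$ adjacent iff $\langle x,y\rangle$ is cyclic (equivalently, both are powers of a common element). The matching number of a graph is the maximum number of pairwise vertex-disjoint edges. -}

module Defs where

open import Level using (0ℓ)
open import Data.Nat using (ℕ; zero; suc; _≤_)
open import Data.Integer using (ℤ; +_; -[1+_])
open import Data.Fin using (Fin)
open import Data.Product using (Σ; ∃; _×_; _,_; proj₁; proj₂)
open import Data.Sum using (_⊎_)
open import Data.List using (List; []; _∷_; length)
open import Data.List.Relation.Unary.All using (All)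
open import Data.List.Relation.Unary.Unique.Propositional using (Unique)
open import Relation.Binary.PropositionalEquality using (_≡_; _≢_)
open import Algebra.Structures using (IsGroup)

-- A finite group, represented (up to isomorphism) as a group structure on
-- the finite carrier  Fin order  with propositional equality.
record FiniteGroup : Set₁ where
  field
    order   : ℕ
    _∙_     : Fin order → Fin order → Fin order
    ε       : Fin order
    _⁻¹     : Fin order → Fin order
    isGroup : IsGroup _≡_ _∙_ ε _⁻¹

  Elt : Set
  Elt = Fin order

  _^ℕ_ : Elt → ℕ → Elt
  x ^ℕ zero  = ε
  x ^ℕ suc k = x ∙ (x ^ℕ k)

  _^_ : Elt → ℤ → Elt
  x ^ (+ k)      = x ^ℕ k
  x ^ -[1+ k ]   = (x ^ℕ suc k) ⁻¹

  IsPowerOf : Elt → Elt → Set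
  IsPowerOf y x = ∃ λ (k : ℤ) → x ^ k ≡ y

  PowerAdj : Elt → Elt → Set
  PowerAdj x y = x ≢ y × (IsPowerOf y x ⊎ IsPowerOf x y)

  -- adjacency in the enhanced power graph P_e(G):
  -- <x,y> cyclic, i.e. both are powers of a common element
  EnhancedPowerAdj : Elt → Elt → Set
  EnhancedPowerAdj x y = x ≢ y × (∃ λ (z : Elt) → IsPowerOf x z × IsPowerOf y z)

vertices : {V : Set} → List (V × V) → List V
vertices []             = []
vertices ((u , v) ∷ es) = u ∷ v ∷ vertices es

IsMatching : {V : Set} → (V → V → Set) → List (V × V) → Set
IsMatching Adj es = All (λ e → Adj (proj₁ e) (proj₂ e)) es × Unique (vertices es)

IsMatchingNumber : {V : Set} → (V → V → Set) → ℕ → Set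
IsMatchingNumber {V} Adj m =
  (∃ λ (es : List (V × V)) → IsMatching Adj es × length es ≡ m)
  × (∀ (es : List (V × V)) → IsMatching Adj es → length es ≤ m)

-- Power-graph matchings are enhanced-power-graph matchings, so it suffices to turn an enhanced matching into a
-- power matching of the same size.  Give a non-power edge {a, b} the weight 2^ℓ, where its level ℓ is the least
-- order of a cyclic subgroup containing a and b, and power edges the weight 0.  Take a non-power edge {x, y} of
-- maximal level m and ⟨z⟩ ∋ x, y with ord z = m; neither x nor y generates ⟨z⟩.  For each generator k of ⟨z⟩,
-- either an exchange of at most three edges trades {x, y} for power edges and at most one edge of level < m,
-- lowering the total weight, or k is matched to a w ∈ ⟨k⟩ that does not generate ⟨z⟩.  If no exchange applies,
-- no two of x, y and these partners lie in a cyclic subgroup of order < m.  Each of them lies in ⟨z^p⟩ for a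
-- prime p ∣ m, so they yield pairwise distinct primes; writing m = p^e c with p ∤ c, the powers z^(c + p^e) are
-- then pairwise distinct generators of ⟨z⟩, two more than ⟨z⟩ has.
module Submission where

open import Defs
open import Level using (0ℓ)
open import Algebra.Bundles using (Group)
open import Algebra.Structures using (IsGroup)
import Algebra.Properties.Group as GroupProperties
open import Data.Nat
open import Data.Nat.Properties
open import Data.Nat.Divisibility
open import Data.Nat.DivMod using (_%_; _/_; m≡m%n+[m/n]*n; m%n<n)
open import Data.Nat.Primality
open import Data.Nat.Primality.Factorisation using (factorise)
open import Data.Nat.Coprimality using (Coprime; coprime?; coprime-Bézout)
open import Data.Nat.GCD using (gcd; gcd[m,n]∣m; gcd[m,n]∣n; gcd-greatest; module Bézout)
open import Data.Nat.Tactic.RingSolver using (solve-∀)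
open import Data.Nat.Induction using (<-wellFounded)
open import Data.Nat.ListAction using (sum; product)
open import Data.Nat.ListAction.Properties using (sum-++; sum-↭)
open import Induction.WellFounded using (Acc; acc)
open import Data.Fin using (Fin; toℕ; fromℕ<; inject; Fin′)
import Data.Fin.Properties as Fin
open import Data.Fin.Properties using (pigeonhole; toℕ<n; toℕ-fromℕ<; toℕ-inject; ¬∀⟶∃¬-smallest)
import Data.Integer as ℤ
open import Data.List using (List; []; _∷_; _++_; length; map; filter; allFin)
open import Data.List.Properties using (length-map; length-++; map-++)
open import Data.List.Extrema.Nat using (min; min≤v⁺; argmin-sel; argmax; argmax-all; f[xs]≤f[argmax])
open import Data.List.Relation.Unary.All as All using (All; []; _∷_)
import Data.List.Relation.Unary.All.Properties as All
open import Data.List.Relation.Unary.Any as Any using (here; there; any?)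
open import Data.List.Relation.Unary.AllPairs as AllPairs using (AllPairs; []; _∷_)
import Data.List.Relation.Unary.AllPairs.Properties as AllPairs
open import Data.List.Relation.Unary.Unique.Propositional using (Unique)
import Data.List.Relation.Unary.Unique.Propositional.Properties as Unique
open import Data.List.Membership.Propositional using (_∈_; _∉_; find)
open import Data.List.Membership.Propositional.Properties
  using (∈-∃++; ∈-map⁺; ∈-map⁻; ∈-filter⁺; ∈-filter⁻; ∈-allFin)
open import Data.List.Relation.Binary.Permutation.Propositional as ↭
  using (_↭_; ↭-refl; ↭-prep; ↭-swap; ↭-trans; ↭-sym; ↭⇒↭ₛ)
open import Data.List.Relation.Binary.Permutation.Propositional.Properties
  using (∈-resp-↭; All-resp-↭; shift; shifts; ++⁺ʳ; ↭-length; map⁺)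
import Data.List.Relation.Binary.Permutation.Setoid.Properties as ↭ₛ
open import Data.Product using (Σ; ∃; ∃₂; _×_; _,_; proj₁; proj₂; uncurry; map₂)
import Data.Product
open import Data.Sum using (_⊎_; inj₁; inj₂; [_,_]′)
import Data.Sum
open import Data.Empty using (⊥; ⊥-elim)
open import Function using (_∘_; id)
open import Relation.Nullary using (¬_; Dec; yes; no; contradiction)
open import Relation.Nullary.Decidable using (map′; ¬?; decidable-stable; _×-dec_; _⊎-dec_)
open import Relation.Unary using (Decidable)
open import Relation.Binary.PropositionalEquality
open import Relation.Binary.Definitions using (tri<; tri≈; tri>)

-- Arithmetic

prime⇒1< : ∀ {p} → Prime p → 1 < p
prime⇒1< {p} pp = nonTrivial⇒n>1 p {{prime⇒nonTrivial pp}}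

∃-prime-divisor : ∀ {n} → 1 < n → ∃ λ p → Prime p × p ∣ n
∃-prime-divisor {n} 1<n with factorise n {{>-nonZero (<-trans z<s 1<n)}}
... | record { factors = [] ; isFactorisation = n≡1 } = contradiction n≡1 (>⇒≢ 1<n)
... | record { factors = p ∷ ps ; isFactorisation = n≡p*Πps ; factorsPrime = pp ∷ _ } =
  p , pp , divides (product ps) (trans n≡p*Πps (*-comm p _))

noCommonPrime⇒coprime : ∀ {a m} → m ≢ 0 → (∀ {p} → Prime p → p ∣ a → p ∣ m → ⊥) → Coprime a m
noCommonPrime⇒coprime m≢0 _ {0} (_ , 0∣m) = contradiction (0∣⇒≡0 0∣m) m≢0
noCommonPrime⇒coprime m≢0 _ {1} _ = refl
noCommonPrime⇒coprime m≢0 noCommonPrime {2+ d} (d∣a , d∣m) with ∃-prime-divisor {2+ d} (s<s z<s)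
... | p , pp , p∣d = ⊥-elim (noCommonPrime pp (∣-trans p∣d d∣a) (∣-trans p∣d d∣m))

¬coprime⇒commonPrime : ∀ {a m} → m ≢ 0 → ¬ Coprime a m → ∃ λ p → Prime p × p ∣ a × p ∣ m
¬coprime⇒commonPrime {a} {m} m≢0 ¬coprime
  with gcd a m | gcd[m,n]∣m a m | gcd[m,n]∣n a m | gcd-greatest {a} {m}
... | 0    | _   | g∣m | _        = contradiction (0∣⇒≡0 g∣m) m≢0
... | 1    | _   | _   | greatest = contradiction (λ {d} (d∣a , d∣m) → ∣1⇒≡1 (greatest d∣a d∣m)) ¬coprime
... | 2+ g | g∣a | g∣m | _ with ∃-prime-divisor {2+ g} (s<s z<s)
...   | p , pp , p∣g = p , pp , ∣-trans p∣g g∣a , ∣-trans p∣g g∣m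

prime∣prime⇒≡ : ∀ {r p} → Prime r → Prime p → r ∣ p → r ≡ p
prime∣prime⇒≡ pr pp r∣p with prime⇒irreducible pp r∣p
... | inj₁ refl = contradiction refl (>⇒≢ (prime⇒1< pr))
... | inj₂ r≡p  = r≡p

prime∣prime^⇒≡ : ∀ {r p} e → Prime r → Prime p → r ∣ p ^ e → r ≡ p
prime∣prime^⇒≡ zero pr pp r∣1 = contradiction (∣1⇒≡1 r∣1) (>⇒≢ (prime⇒1< pr))
prime∣prime^⇒≡ {p = p} (suc e) pr pp r∣p^1+e with euclidsLemma p (p ^ e) pr r∣p^1+e
... | inj₁ r∣p   = prime∣prime⇒≡ pr pp r∣p
... | inj₂ r∣p^e = prime∣prime^⇒≡ e pr pp r∣p^e

private
  sum-product-determines-≤ : ∀ {a b a′ b′} → a ≤ a′ → a + b ≡ a′ + b′ → a * b ≡ a′ * b′ → a ≡ a′ ⊎ a ≡ b′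
  sum-product-determines-≤ {a} {b} {_} {b′} a≤a′ sum≡ prod≡ with m≤n⇒∃[o]m+o≡n a≤a′
  ... | t , refl = cancel t ta≡tb′
    where
    b≡t+b′ : b ≡ t + b′
    b≡t+b′ = +-cancelˡ-≡ a b (t + b′) (trans sum≡ (+-assoc a t b′))
    ta≡tb′ : t * a ≡ t * b′
    ta≡tb′ = +-cancelˡ-≡ (a * b′) (t * a) (t * b′) (begin
      a * b′ + t * a  ≡⟨ cong (a * b′ +_) (*-comm t a) ⟩
      a * b′ + a * t  ≡⟨ +-comm (a * b′) (a * t) ⟩
      a * t + a * b′  ≡⟨ *-distribˡ-+ a t b′ ⟨
      a * (t + b′)    ≡⟨ cong (a *_) b≡t+b′ ⟨
      a * b           ≡⟨ prod≡ ⟩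
      (a + t) * b′    ≡⟨ *-distribʳ-+ b′ a t ⟩
      a * b′ + t * b′ ∎)
      where open ≡-Reasoning
    cancel : ∀ s → s * a ≡ s * b′ → a ≡ a + s ⊎ a ≡ b′
    cancel zero    _  = inj₁ (sym (+-identityʳ a))
    cancel (suc s) eq = inj₂ (*-cancelˡ-≡ a b′ (suc s) eq)

sum-product-determines : ∀ {a b a′ b′} → a + b ≡ a′ + b′ → a * b ≡ a′ * b′ → a ≡ a′ ⊎ a ≡ b′
sum-product-determines {a} {b} {a′} {b′} sum≡ prod≡ with ≤-total a a′
... | inj₁ a≤a′ = sum-product-determines-≤ a≤a′ sum≡ prod≡
... | inj₂ a′≤a with sum-product-determines-≤ a′≤a (sym sum≡) (sym prod≡)
...   | inj₁ a′≡a = inj₁ (sym a′≡a)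
...   | inj₂ a′≡b = inj₂ (+-cancelʳ-≡ b a b′ (trans sum≡ (trans (cong (_+ b′) a′≡b) (+-comm b b′))))

m+n≤m*n : ∀ {m n} → 2 ≤ m → 2 ≤ n → m + n ≤ m * n
m+n≤m*n {2+ m} {2+ n} _ _ = subst (2+ m + 2+ n ≤_) (sym (expand m n)) (m≤m+n (2+ m + 2+ n) (m + n + m * n))
  where
  expand : ∀ m n → 2+ m * 2+ n ≡ (2+ m + 2+ n) + (m + n + m * n)
  expand = solve-∀
m+n≤m*n {1}    (s<s ()) _
m+n≤m*n {2+ _} {1} _ (s<s ())

record PrimeSplit (p m : ℕ) : Set where
  constructor split
  field
    exponent   : ℕ
    cofactor   : ℕ
    m≡pᵉ*c     : m ≡ p ^ exponent * cofactor
    p∤cofactor : p ∤ cofactor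

opaque
  primeSplit : ∀ {p} → Prime p → ∀ m → .{{NonZero m}} → PrimeSplit p m
  primeSplit {p} pp m = go m (<-wellFounded m)
    where
    instance
      _ : NonTrivial p
      _ = prime⇒nonTrivial pp
    go : ∀ m → .{{NonZero m}} → Acc _<_ m → PrimeSplit p m
    go m (acc rec) with p ∣? m
    ... | no p∤m = split 0 m (sym (+-identityʳ m)) p∤m
    ... | yes p∣m@(divides q m≡q*p) with go q {{quotient≢0 p∣m}} (rec (quotient-< p∣m))
    ...   | split e c q≡pᵉ*c p∤c = split (suc e) c m≡p¹⁺ᵉ*c p∤c
      where
      m≡p¹⁺ᵉ*c : m ≡ p ^ suc e * c
      m≡p¹⁺ᵉ*c = begin
        m               ≡⟨ m≡q*p ⟩
        q * p           ≡⟨ *-comm q p ⟩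
        p * q           ≡⟨ cong (p *_) q≡pᵉ*c ⟩
        p * (p ^ e * c) ≡⟨ *-assoc p (p ^ e) c ⟨
        p ^ suc e * c   ∎
        where open ≡-Reasoning

partSum : ∀ {p m} → PrimeSplit p m → ℕ
partSum {p} (split e c _ _) = c + p ^ e

module _ {p m} (pp : Prime p) (p∣m : p ∣ m) where

  p∣pᵉ : (s : PrimeSplit p m) → p ∣ p ^ PrimeSplit.exponent s
  p∣pᵉ (split zero    c m≡c p∤c) = contradiction (subst (p ∣_) (trans m≡c (+-identityʳ c)) p∣m) p∤c
  p∣pᵉ (split (suc e) _ _   _)   = m∣m*n (p ^ e)

  prime∣m⇒≡p⊎∣cofactor : ∀ {r} → Prime r → r ∣ m → (s : PrimeSplit p m) → r ≡ p ⊎ r ∣ PrimeSplit.cofactor s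
  prime∣m⇒≡p⊎∣cofactor pr r∣m (split e c m≡pᵉ*c _) with euclidsLemma (p ^ e) c pr (subst (_ ∣_) m≡pᵉ*c r∣m)
  ... | inj₁ r∣pᵉ = inj₁ (prime∣prime^⇒≡ e pr pp r∣pᵉ)
  ... | inj₂ r∣c  = inj₂ r∣c

  partSum-coprime : .{{NonZero m}} → (s : PrimeSplit p m) → Coprime (partSum s) m
  partSum-coprime s@(split e c _ p∤c) = noCommonPrime⇒coprime (≢-nonZero⁻¹ m) noCommonPrime
    where
    noCommonPrime : ∀ {r} → Prime r → r ∣ c + p ^ e → r ∣ m → ⊥
    noCommonPrime pr r∣sum r∣m with prime∣m⇒≡p⊎∣cofactor pr r∣m s
    ... | inj₁ refl = p∤c (∣m+n∣m⇒∣n (subst (p ∣_) (+-comm c (p ^ e)) r∣sum) (p∣pᵉ s))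
    ... | inj₂ r∣c with prime∣prime^⇒≡ e pr pp (∣m+n∣m⇒∣n r∣sum r∣c)
    ...   | refl = p∤c r∣c

  partSum<m : .{{NonZero m}} → ∀ {r} → Prime r → r ∣ m → r ≢ p → (s : PrimeSplit p m) → partSum s < m
  partSum<m {r} pr r∣m r≢p s@(split e c m≡pᵉ*c p∤c) = ≤∧≢⇒< partSum≤m partSum≢m
    where
    r∣c : r ∣ c
    r∣c = [ (λ r≡p → contradiction r≡p r≢p) , id ]′ (prime∣m⇒≡p⊎∣cofactor pr r∣m s)
    instance
      _ : NonZero (p ^ e * c)
      _ = ≢-nonZero (λ pᵉ*c≡0 → ≢-nonZero⁻¹ m (trans m≡pᵉ*c pᵉ*c≡0))
    2≤c : 2 ≤ c
    2≤c = ≤-trans (prime⇒1< pr) (∣⇒≤ {{m*n≢0⇒n≢0 (p ^ e)}} r∣c)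
    2≤pᵉ : 2 ≤ p ^ e
    2≤pᵉ = ≤-trans (prime⇒1< pp) (∣⇒≤ {{m*n≢0⇒m≢0 (p ^ e)}} (p∣pᵉ s))
    partSum≤m : c + p ^ e ≤ m
    partSum≤m = subst (c + p ^ e ≤_) (trans (*-comm c (p ^ e)) (sym m≡pᵉ*c)) (m+n≤m*n 2≤c 2≤pᵉ)
    partSum≢m : c + p ^ e ≢ m
    partSum≢m sum≡m = >⇒≢ (≤-trans (prime⇒1< pp) (∣⇒≤ p∣m))
                          (partSum-coprime s (subst (m ∣_) (sym sum≡m) ∣-refl , ∣-refl))

partSum-injective : ∀ {p p′ m} → Prime p → Prime p′ → p ∣ m → p ≢ p′ →
                    (s : PrimeSplit p m) (s′ : PrimeSplit p′ m) → partSum s ≡ partSum s′ →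
                    ∀ {r} → Prime r → r ∣ m → r ≡ p ⊎ r ≡ p′
partSum-injective {p} {p′} pp pp′ p∣m p≢p′ s@(split e c m≡pᵉ*c _) (split e′ c′ m≡p′ᵉ′*c′ _) sum≡ pr r∣m
  with sum-product-determines {c} {p ^ e} {c′} {p′ ^ e′} sum≡ prod≡
  where
  prod≡ : c * p ^ e ≡ c′ * p′ ^ e′
  prod≡ = trans (*-comm c (p ^ e)) (trans (sym m≡pᵉ*c) (trans m≡p′ᵉ′*c′ (*-comm (p′ ^ e′) c′)))
... | inj₁ refl = contradiction (prime∣prime^⇒≡ e′ pp pp′ (subst (p ∣_) (+-cancelˡ-≡ c _ _ sum≡) (p∣pᵉ pp p∣m s))) p≢p′
... | inj₂ c≡p′ᵉ′ with prime∣m⇒≡p⊎∣cofactor pp p∣m pr r∣m s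
...   | inj₁ r≡p = inj₁ r≡p
...   | inj₂ r∣c = inj₂ (prime∣prime^⇒≡ e′ pr pp′ (subst (_ ∣_) c≡p′ᵉ′ r∣c))

record PrimeDivisor (m : ℕ) : Set where
  constructor primeDivisor
  field
    p       : ℕ
    isPrime : Prime p
    p∣m     : p ∣ m

module _ {m} .{{_ : NonZero m}} where
  open PrimeDivisor

  unit : PrimeDivisor m → ℕ
  unit d = partSum (primeSplit (isPrime d) m)

  unit-coprime : ∀ d → Coprime (unit d) m
  unit-coprime d = partSum-coprime (isPrime d) (p∣m d) (primeSplit (isPrime d) m)

  -- Two primes do not suffice: for m = 6 both give the unit 5.
  module ThreeDistinctPrimes (d₁ d₂ d₃ : PrimeDivisor m)
                             (p₁≢p₂ : p d₁ ≢ p d₂) (p₁≢p₃ : p d₁ ≢ p d₃) (p₂≢p₃ : p d₂ ≢ p d₃) where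

    private
      avoiding-d₁ : ∀ a b → p d₁ ≡ a → ∃ λ d → p d ≢ a × p d ≢ b
      avoiding-d₁ a b refl with p d₂ ≟ b
      ... | no p₂≢b  = d₂ , p₁≢p₂ ∘ sym , p₂≢b
      ... | yes refl = d₃ , p₁≢p₃ ∘ sym , p₂≢p₃ ∘ sym

    avoiding : ∀ a b → ∃ λ d → p d ≢ a × p d ≢ b
    avoiding a b with p d₁ ≟ a | p d₁ ≟ b
    ... | yes p₁≡a | _        = avoiding-d₁ a b p₁≡a
    ... | no _     | yes p₁≡b = map₂ Data.Product.swap (avoiding-d₁ b a p₁≡b)
    ... | no p₁≢a  | no p₁≢b  = d₁ , p₁≢a , p₁≢b

    unit<m : ∀ d → unit d < m
    unit<m d with avoiding (p d) (p d)
    ... | r , r≢p , _ = partSum<m (isPrime d) (p∣m d) (isPrime r) (p∣m r) r≢p (primeSplit (isPrime d) m)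

    unit-injective : ∀ d d′ → p d ≢ p d′ → unit d ≢ unit d′
    unit-injective d d′ p≢p′ unit≡ with avoiding (p d) (p d′)
    ... | r , r≢p , r≢p′ = [ r≢p , r≢p′ ]′
      (partSum-injective (isPrime d) (isPrime d′) (p∣m d) p≢p′ (primeSplit (isPrime d) m) (primeSplit (isPrime d′) m)
                         unit≡ (isPrime r) (p∣m r))

-- Lists, permutations and matchings

module _ {A : Set} where

  Unique-resp-↭ : ∀ {xs ys : List A} → xs ↭ ys → Unique xs → Unique ys
  Unique-resp-↭ xs↭ys = ↭ₛ.Unique-resp-↭ (setoid A) (↭⇒↭ₛ xs↭ys)

  Unique-++⁻ˡ : ∀ xs {ys : List A} → Unique (xs ++ ys) → Unique xs
  Unique-++⁻ˡ []       _              = []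
  Unique-++⁻ˡ (x ∷ xs) (x∉ ∷ unique) = All.++⁻ˡ xs x∉ ∷ Unique-++⁻ˡ xs unique

  ∈⇒↭∷ : ∀ {x : A} {xs} → x ∈ xs → ∃ λ ys → xs ↭ x ∷ ys
  ∈⇒↭∷ {x} x∈xs with ∈-∃++ x∈xs
  ... | ys , zs , refl = ys ++ zs , shift x ys zs

  ∈⇒length>0 : ∀ {x : A} {xs} → x ∈ xs → 0 < length xs
  ∈⇒length>0 {xs = _ ∷ _} _ = z<s

  ∈-↭∷⁻ : ∀ {x y : A} {xs ys} → x ∈ xs → xs ↭ y ∷ ys → x ≢ y → x ∈ ys
  ∈-↭∷⁻ x∈xs xs↭y∷ys x≢y with ∈-resp-↭ xs↭y∷ys x∈xs
  ... | here x≡y = contradiction x≡y x≢y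
  ... | there x∈ys = x∈ys

  ∈₂⇒↭∷∷ : ∀ {x y : A} {xs} → x ∈ xs → y ∈ xs → y ≢ x → ∃ λ ys → xs ↭ x ∷ y ∷ ys
  ∈₂⇒↭∷∷ x∈xs y∈xs y≢x with ∈⇒↭∷ x∈xs
  ... | ys , xs↭x∷ys with ∈⇒↭∷ (∈-↭∷⁻ y∈xs xs↭x∷ys y≢x)
  ...   | zs , ys↭y∷zs = zs , ↭-trans xs↭x∷ys (↭-prep _ ys↭y∷zs)

  Unique∧⊆⇒length≤ : ∀ {xs ys : List A} → Unique xs → All (_∈ ys) xs → length xs ≤ length ys
  Unique∧⊆⇒length≤ [] [] = z≤n
  Unique∧⊆⇒length≤ {x ∷ xs} (x∉xs ∷ unique) (x∈ys ∷ xs⊆ys) with ∈⇒↭∷ x∈ys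
  ... | ys′ , ys↭x∷ys′ =
    ≤-trans (s≤s (Unique∧⊆⇒length≤ unique (⊆ys′ x∉xs xs⊆ys))) (≤-reflexive (sym (↭-length ys↭x∷ys′)))
    where
    ⊆ys′ : ∀ {zs} → All (x ≢_) zs → All (_∈ _) zs → All (_∈ ys′) zs
    ⊆ys′ [] [] = []
    ⊆ys′ (x≢z ∷ x≢zs) (z∈ys ∷ zs⊆ys) = ∈-↭∷⁻ z∈ys ys↭x∷ys′ (x≢z ∘ sym) ∷ ⊆ys′ x≢zs zs⊆ys

  All¬⊎∃ : ∀ {P : A → Set} → Decidable P → ∀ xs → All (¬_ ∘ P) xs ⊎ ∃ λ x → x ∈ xs × P x
  All¬⊎∃ P? xs with any? P? xs
  ... | yes some = inj₂ (find some)
  ... | no  none = inj₁ (All.¬Any⇒All¬ xs none)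

  AllPairs¬⊎∃ : ∀ {R S : A → A → Set} → (∀ x y → Dec (R x y)) → ∀ {xs} → AllPairs S xs →
                AllPairs (λ x y → ¬ R x y) xs ⊎ ∃₂ λ x y → S x y × R x y
  AllPairs¬⊎∃ R? [] = inj₁ []
  AllPairs¬⊎∃ R? {x ∷ xs} (Sx ∷ Sxs) with any? (R? x) xs
  ... | yes some with find some
  ...   | y , y∈xs , Rxy = inj₂ (x , y , All.lookup Sx y∈xs , Rxy)
  AllPairs¬⊎∃ R? {x ∷ xs} (Sx ∷ Sxs) | no none with AllPairs¬⊎∃ R? Sxs
  ...   | inj₁ ¬Rxs = inj₁ (All.¬Any⇒All¬ xs none ∷ ¬Rxs)
  ...   | inj₂ found = inj₂ found

module _ {V : Set} where

  Joins : V → V → V × V → Set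
  Joins k w e = e ≡ (k , w) ⊎ e ≡ (w , k)

  vertices-++ : ∀ (es fs : List (V × V)) → vertices (es ++ fs) ≡ vertices es ++ vertices fs
  vertices-++ []             fs = refl
  vertices-++ ((u , v) ∷ es) fs = cong (λ vs → u ∷ v ∷ vs) (vertices-++ es fs)

  vertices-↭ : ∀ {es fs : List (V × V)} → es ↭ fs → vertices es ↭ vertices fs
  vertices-↭ ↭.refl                      = ↭-refl
  vertices-↭ (↭.prep (u , v) es↭fs)      = ↭-prep u (↭-prep v (vertices-↭ es↭fs))
  vertices-↭ (↭.swap (a , b) (c , d) es↭fs) =
    ↭-trans (shifts (a ∷ b ∷ []) (c ∷ d ∷ [])) (↭-prep c (↭-prep d (↭-prep a (↭-prep b (vertices-↭ es↭fs)))))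
  vertices-↭ (↭.trans es↭gs gs↭fs)       = ↭-trans (vertices-↭ es↭gs) (vertices-↭ gs↭fs)

  vertices-joins : ∀ {k w e} es → Joins k w e → vertices (e ∷ es) ↭ k ∷ w ∷ vertices es
  vertices-joins es (inj₁ refl) = ↭-refl
  vertices-joins es (inj₂ refl) = ↭-swap _ _ ↭-refl

  ∈-vertices⇒joins : ∀ {k} es → k ∈ vertices es → ∃₂ λ w e → e ∈ es × Joins k w e
  ∈-vertices⇒joins ((u , v) ∷ es) (here refl)         = v , (u , v) , here refl , inj₁ refl
  ∈-vertices⇒joins ((u , v) ∷ es) (there (here refl)) = u , (u , v) , here refl , inj₂ refl
  ∈-vertices⇒joins ((u , v) ∷ es) (there (there k∈)) with ∈-vertices⇒joins es k∈
  ... | w , e , e∈es , joins = w , e , there e∈es , joins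

  joins⇒∈-vertices : ∀ {k w e es} → e ∈ es → Joins k w e → k ∈ vertices es × w ∈ vertices es
  joins⇒∈-vertices {es = _ ∷ _} (here refl) (inj₁ refl) = here refl , there (here refl)
  joins⇒∈-vertices {es = _ ∷ _} (here refl) (inj₂ refl) = there (here refl) , here refl
  joins⇒∈-vertices {es = _ ∷ _} (there e∈es) joins with joins⇒∈-vertices e∈es joins
  ... | k∈ , w∈ = there (there k∈) , there (there w∈)

  Edge : (V → V → Set) → V × V → Set
  Edge Adj (u , v) = Adj u v

  MatchingOfSize : (V → V → Set) → ℕ → Set
  MatchingOfSize Adj n = ∃ λ es → IsMatching Adj es × length es ≡ n

  module _ {Adj : V → V → Set} where

    IsMatching-resp-↭ : ∀ {es fs} → es ↭ fs → IsMatching Adj es → IsMatching Adj fs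
    IsMatching-resp-↭ es↭fs (adjacent , unique) = All-resp-↭ es↭fs adjacent , Unique-resp-↭ (vertices-↭ es↭fs) unique

    IsMatching-exchange : ∀ old new rest → IsMatching Adj (old ++ rest) → vertices new ↭ vertices old →
                          (Unique (vertices new) → All (Edge Adj) new) → IsMatching Adj (new ++ rest)
    IsMatching-exchange old new rest (adjacent , unique) new↭old newAdjacent =
      All.++⁺ (newAdjacent (Unique-++⁻ˡ (vertices new) unique′)) (All.++⁻ʳ old adjacent) ,
      subst Unique (sym (vertices-++ new rest)) unique′
      where
      unique′ : Unique (vertices new ++ vertices rest)
      unique′ = Unique-resp-↭ (++⁺ʳ (vertices rest) (↭-sym new↭old)) (subst Unique (vertices-++ old rest) unique)

    sameMatchingNumber : ∀ {Sub : V → V → Set} → (∀ {a b} → Sub a b → Adj a b) →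
                         (∀ {es} → IsMatching Adj es → MatchingOfSize Sub (length es)) →
                         ∀ m → (IsMatchingNumber Sub m → IsMatchingNumber Adj m)
                             × (IsMatchingNumber Adj m → IsMatchingNumber Sub m)
    sameMatchingNumber {Sub} sub⇒adj shrink m = fromSub , toSub
      where
      weaken : ∀ {es} → IsMatching Sub es → IsMatching Adj es
      weaken (adjacent , unique) = All.map sub⇒adj adjacent , unique
      fromSub : IsMatchingNumber Sub m → IsMatchingNumber Adj m
      fromSub ((es , matching , length≡m) , maximum) = (es , weaken matching , length≡m) , bound
        where
        bound : ∀ es′ → IsMatching Adj es′ → length es′ ≤ m
        bound es′ matching′ with shrink matching′
        ... | es″ , matching″ , length≡ = subst (_≤ m) length≡ (maximum es″ matching″)
      toSub : IsMatchingNumber Adj m → IsMatchingNumber Sub m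
      toSub ((es , matching , length≡m) , maximum) with shrink matching
      ... | es′ , matching′ , length≡ = (es′ , matching′ , trans length≡ length≡m) , λ es″ → maximum es″ ∘ weaken

-- Powers and orders in a finite group

module _ (G : FiniteGroup) where

  open FiniteGroup G hiding (_^_)
  open IsGroup isGroup using (assoc; identityˡ; identityʳ)

  private
    group : Group 0ℓ 0ℓ
    group = record { isGroup = isGroup }

  open import Data.List.Membership.DecPropositional (Fin._≟_ {order}) using (_∈?_)
  open GroupProperties group using (∙-cancelˡ; inverseˡ-unique; inverseʳ-unique)

  ^ℕ-+ : ∀ x a b → x ^ℕ (a + b) ≡ (x ^ℕ a) ∙ (x ^ℕ b)
  ^ℕ-+ x zero    b = sym (identityˡ _)
  ^ℕ-+ x (suc a) b = trans (cong (x ∙_) (^ℕ-+ x a b)) (sym (assoc x _ _))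

  ε^ℕ : ∀ k → ε ^ℕ k ≡ ε
  ε^ℕ zero    = refl
  ε^ℕ (suc k) = trans (identityˡ _) (ε^ℕ k)

  ^ℕ-* : ∀ x a b → x ^ℕ (a * b) ≡ (x ^ℕ a) ^ℕ b
  ^ℕ-* x a zero    = cong (x ^ℕ_) (*-zeroʳ a)
  ^ℕ-* x a (suc b) = trans (cong (x ^ℕ_) (*-suc a b)) (trans (^ℕ-+ x a (a * b)) (cong ((x ^ℕ a) ∙_) (^ℕ-* x a b)))

  ^ℕ-1 : ∀ x → x ^ℕ 1 ≡ x
  ^ℕ-1 = identityʳ

  ^ℕ-cancelˡ : ∀ x a b → x ^ℕ a ≡ x ^ℕ (a + b) → x ^ℕ b ≡ ε
  ^ℕ-cancelˡ x a b xᵃ≡xᵃ⁺ᵇ = sym (∙-cancelˡ (x ^ℕ a) ε (x ^ℕ b) (trans (identityʳ _) (trans xᵃ≡xᵃ⁺ᵇ (^ℕ-+ x a b))))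

  ∃-period : ∀ x → ∃ λ k → k < order × x ^ℕ suc k ≡ ε
  ∃-period x with pigeonhole (n<1+n order) (λ i → x ^ℕ toℕ i)
  ... | i , j , i<j , xⁱ≡xʲ with m≤n⇒∃[o]m+o≡n i<j
  ... | k , 1+i+k≡j = k , k<order , ^ℕ-cancelˡ x (toℕ i) (suc k) (trans xⁱ≡xʲ (cong (x ^ℕ_) i+1+k≡j))
    where
    i+1+k≡j : toℕ j ≡ toℕ i + suc k
    i+1+k≡j = trans (sym 1+i+k≡j) (sym (+-suc (toℕ i) k))
    k<order : k < order
    k<order = ≤-trans (s≤s (m≤n+m k (toℕ i))) (≤-trans (≤-reflexive 1+i+k≡j) (≤-pred (toℕ<n j)))

  private opaque
    leastPeriod : ∀ x → ∃ λ (i : Fin order) →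
                  ¬ x ^ℕ suc (toℕ i) ≢ ε × ((j : Fin′ i) → x ^ℕ suc (toℕ (inject j)) ≢ ε)
    leastPeriod x =
      ¬∀⟶∃¬-smallest order (λ i → x ^ℕ suc (toℕ i) ≢ ε) (λ i → ¬? (x ^ℕ suc (toℕ i) Fin.≟ ε)) noPeriodFails
      where
      noPeriodFails : ¬ (∀ (i : Fin order) → x ^ℕ suc (toℕ i) ≢ ε)
      noPeriodFails noPeriod with ∃-period x
      ... | k , k<order , xᵏ⁺¹≡ε =
        noPeriod (fromℕ< k<order) (subst (λ j → x ^ℕ suc j ≡ ε) (sym (toℕ-fromℕ< k<order)) xᵏ⁺¹≡ε)

  ord : Elt → ℕ
  ord x = suc (toℕ (proj₁ (leastPeriod x)))

  instance
    ord-nonZero : ∀ {x} → NonZero (ord x)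
    ord-nonZero = _

  ord≤order : ∀ x → ord x ≤ order
  ord≤order x = toℕ<n (proj₁ (leastPeriod x))

  ^ord≡ε : ∀ x → x ^ℕ ord x ≡ ε
  ^ord≡ε x = decidable-stable (_ Fin.≟ ε) (proj₁ (proj₂ (leastPeriod x)))

  ^≢ε-below-ord : ∀ x {k} → suc k < ord x → x ^ℕ suc k ≢ ε
  ^≢ε-below-ord x {k} 1+k<ord =
    subst (λ j → x ^ℕ suc j ≢ ε) (trans (toℕ-inject j) (toℕ-fromℕ< k<i)) (proj₂ (proj₂ (leastPeriod x)) j)
    where
    k<i = ≤-pred 1+k<ord
    j = fromℕ< k<i

  ord-minimal : ∀ x {k} → 0 < k → x ^ℕ k ≡ ε → ord x ≤ k
  ord-minimal x {suc k} _ xᵏ≡ε with ord x ≤? suc k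
  ... | yes ord≤k = ord≤k
  ... | no  ord≰k = contradiction xᵏ≡ε (^≢ε-below-ord x (≰⇒> ord≰k))

  ^[q*ord]≡ε : ∀ x q → x ^ℕ (q * ord x) ≡ ε
  ^[q*ord]≡ε x q = begin
    x ^ℕ (q * ord x)     ≡⟨ cong (x ^ℕ_) (*-comm q (ord x)) ⟩
    x ^ℕ (ord x * q)     ≡⟨ ^ℕ-* x (ord x) q ⟩
    (x ^ℕ ord x) ^ℕ q    ≡⟨ cong (_^ℕ q) (^ord≡ε x) ⟩
    ε ^ℕ q               ≡⟨ ε^ℕ q ⟩
    ε                    ∎
    where open ≡-Reasoning

  ^ℕ-mod-ord : ∀ x k → x ^ℕ k ≡ x ^ℕ (k % ord x)
  ^ℕ-mod-ord x k = begin
    x ^ℕ k                                          ≡⟨ cong (x ^ℕ_) (m≡m%n+[m/n]*n k (ord x)) ⟩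
    x ^ℕ (k % ord x + k / ord x * ord x)            ≡⟨ ^ℕ-+ x (k % ord x) _ ⟩
    (x ^ℕ (k % ord x)) ∙ (x ^ℕ (k / ord x * ord x)) ≡⟨ cong ((x ^ℕ (k % ord x)) ∙_) (^[q*ord]≡ε x (k / ord x)) ⟩
    (x ^ℕ (k % ord x)) ∙ ε                          ≡⟨ identityʳ _ ⟩
    x ^ℕ (k % ord x)                                ∎
    where open ≡-Reasoning

  private
    ^ℕ-distinct-below-ord : ∀ x {i j} → i < j → j < ord x → x ^ℕ i ≢ x ^ℕ j
    ^ℕ-distinct-below-ord x {i} i<j j<ord xⁱ≡xʲ with m≤n⇒∃[o]m+o≡n i<j
    ... | k , refl = ^≢ε-below-ord x (≤-<-trans (s≤s (m≤n+m k i)) j<ord)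
                       (^ℕ-cancelˡ x i (suc k) (trans xⁱ≡xʲ (cong (x ^ℕ_) (sym (+-suc i k)))))

  ^ℕ-injective-below-ord : ∀ x {i j} → i < ord x → j < ord x → x ^ℕ i ≡ x ^ℕ j → i ≡ j
  ^ℕ-injective-below-ord x {i} {j} i<ord j<ord xⁱ≡xʲ with <-cmp i j
  ... | tri< i<j _ _ = contradiction xⁱ≡xʲ (^ℕ-distinct-below-ord x i<j j<ord)
  ... | tri≈ _ i≡j _ = i≡j
  ... | tri> _ _ j<i = contradiction (sym xⁱ≡xʲ) (^ℕ-distinct-below-ord x j<i i<ord)

  infix 4 _∈⟨_⟩
  _∈⟨_⟩ : Elt → Elt → Set
  y ∈⟨ x ⟩ = ∃ λ k → x ^ℕ k ≡ y

  ∈⟨⟩-refl : ∀ x → x ∈⟨ x ⟩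
  ∈⟨⟩-refl x = 1 , ^ℕ-1 x

  ∈⟨⟩-trans : ∀ {x y z} → y ∈⟨ x ⟩ → z ∈⟨ y ⟩ → z ∈⟨ x ⟩
  ∈⟨⟩-trans {x} (a , refl) (b , refl) = a * b , ^ℕ-* x a b

  ⁻¹∈⟨⟩ : ∀ x → x ⁻¹ ∈⟨ x ⟩
  ⁻¹∈⟨⟩ x = pred (ord x) , inverseʳ-unique x _ (^ord≡ε x)

  IsPowerOf⇒∈⟨⟩ : ∀ {y x} → IsPowerOf y x → y ∈⟨ x ⟩
  IsPowerOf⇒∈⟨⟩ (ℤ.+ k , xᵏ≡y) = k , xᵏ≡y
  IsPowerOf⇒∈⟨⟩ {x = x} (ℤ.-[1+ k ] , refl) = ∈⟨⟩-trans (suc k , refl) (⁻¹∈⟨⟩ (x ^ℕ suc k))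

  ∈⟨⟩⇒IsPowerOf : ∀ {y x} → y ∈⟨ x ⟩ → IsPowerOf y x
  ∈⟨⟩⇒IsPowerOf (k , xᵏ≡y) = ℤ.+ k , xᵏ≡y

  opaque
    _∈⟨_⟩? : ∀ y x → Dec (y ∈⟨ x ⟩)
    y ∈⟨ x ⟩? = map′ (λ (i , xⁱ≡y) → toℕ i , xⁱ≡y) bounded (Fin.any? (λ i → x ^ℕ toℕ i Fin.≟ y))
      where
      bounded : y ∈⟨ x ⟩ → ∃ λ (i : Fin order) → x ^ℕ toℕ i ≡ y
      bounded (k , xᵏ≡y) =
        fromℕ< k%ord<order , trans (cong (x ^ℕ_) (toℕ-fromℕ< k%ord<order)) (trans (sym (^ℕ-mod-ord x k)) xᵏ≡y)
        where
        k%ord<order : k % ord x < order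
        k%ord<order = <-≤-trans (m%n<n k (ord x)) (ord≤order x)

  coprime⇒∈⟨^⟩ : ∀ u b → Coprime b (ord u) → u ∈⟨ u ^ℕ b ⟩
  coprime⇒∈⟨^⟩ u b coprime with coprime-Bézout coprime
  ... | Bézout.+- k l 1+l*ord≡k*b = k , (begin
    (u ^ℕ b) ^ℕ k                  ≡⟨ ^ℕ-* u b k ⟨
    u ^ℕ (b * k)                   ≡⟨ cong (u ^ℕ_) (trans (*-comm b k) (sym 1+l*ord≡k*b)) ⟩
    u ^ℕ (1 + l * ord u)           ≡⟨ ^ℕ-+ u 1 (l * ord u) ⟩
    (u ^ℕ 1) ∙ (u ^ℕ (l * ord u))  ≡⟨ cong₂ _∙_ (^ℕ-1 u) (^[q*ord]≡ε u l) ⟩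
    u ∙ ε                          ≡⟨ identityʳ u ⟩
    u                              ∎)
    where open ≡-Reasoning
  ... | Bézout.-+ k l 1+k*b≡l*ord = subst (_∈⟨ u ^ℕ b ⟩) (sym u≡w⁻¹) (∈⟨⟩-trans (k , refl) (⁻¹∈⟨⟩ _))
    where
    w = (u ^ℕ b) ^ℕ k
    u≡w⁻¹ : u ≡ w ⁻¹
    u≡w⁻¹ = inverseˡ-unique u w (begin
      u ∙ w                          ≡⟨ cong₂ _∙_ (^ℕ-1 u) (^ℕ-* u b k) ⟨
      (u ^ℕ 1) ∙ (u ^ℕ (b * k))      ≡⟨ ^ℕ-+ u 1 (b * k) ⟨
      u ^ℕ (1 + b * k)               ≡⟨ cong (λ j → u ^ℕ (1 + j)) (*-comm b k) ⟩
      u ^ℕ (1 + k * b)               ≡⟨ cong (u ^ℕ_) 1+k*b≡l*ord ⟩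
      u ^ℕ (l * ord u)               ≡⟨ ^[q*ord]≡ε u l ⟩
      ε                              ∎)
      where open ≡-Reasoning

  ¬coprime⇒ord<ord : ∀ u b → ¬ Coprime b (ord u) → ord (u ^ℕ b) < ord u
  ¬coprime⇒ord<ord u b ¬coprime with ¬coprime⇒commonPrime (≢-nonZero⁻¹ (ord u)) ¬coprime
  ... | p , pp , divides b′ b≡b′*p , divides o ord≡o*p = ≤-<-trans (ord-minimal (u ^ℕ b) 0<o [uᵇ]ᵒ≡ε) o<ord
    where
    instance
      _ : NonZero o
      _ = m*n≢0⇒m≢0 o {{subst NonZero ord≡o*p ord-nonZero}}
    0<o : 0 < o
    0<o = >-nonZero⁻¹ o
    o<ord : o < ord u
    o<ord = subst (o <_) (sym ord≡o*p) (m<m*n o p (prime⇒1< pp))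
    [uᵇ]ᵒ≡ε : (u ^ℕ b) ^ℕ o ≡ ε
    [uᵇ]ᵒ≡ε = begin
      (u ^ℕ b) ^ℕ o       ≡⟨ ^ℕ-* u b o ⟨
      u ^ℕ (b * o)        ≡⟨ cong (λ j → u ^ℕ (j * o)) b≡b′*p ⟩
      u ^ℕ (b′ * p * o)   ≡⟨ cong (u ^ℕ_) (*-assoc b′ p o) ⟩
      u ^ℕ (b′ * (p * o)) ≡⟨ cong (λ j → u ^ℕ (b′ * j)) (trans (*-comm p o) (sym ord≡o*p)) ⟩
      u ^ℕ (b′ * ord u)   ≡⟨ ^[q*ord]≡ε u b′ ⟩
      ε                   ∎
      where open ≡-Reasoning

  ∈⟨⟩∧ord≤⇒∈⟨⟩ : ∀ {z u} → z ∈⟨ u ⟩ → ord u ≤ ord z → u ∈⟨ z ⟩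
  ∈⟨⟩∧ord≤⇒∈⟨⟩ {u = u} (b , refl) ord≤ with coprime? b (ord u)
  ... | yes coprime  = coprime⇒∈⟨^⟩ u b coprime
  ... | no ¬coprime = contradiction ord≤ (<⇒≱ (¬coprime⇒ord<ord u b ¬coprime))

  infix 4 _generates⟨_⟩
  _generates⟨_⟩ : Elt → Elt → Set
  k generates⟨ z ⟩ = k ∈⟨ z ⟩ × z ∈⟨ k ⟩

  _generates⟨_⟩? : ∀ k z → Dec (k generates⟨ z ⟩)
  k generates⟨ z ⟩? = k ∈⟨ z ⟩? ×-dec z ∈⟨ k ⟩?

  ProperPower : Elt → Elt → Set
  ProperPower z b = b ∈⟨ z ⟩ × ¬ z ∈⟨ b ⟩

  CommonRootsAtLeast : ℕ → Elt → Elt → Set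
  CommonRootsAtLeast m a b = ∀ u → a ∈⟨ u ⟩ → b ∈⟨ u ⟩ → m ≤ ord u

  module _ (z : Elt) where
    open PrimeDivisor

    ord[z^p]<ord : (d : PrimeDivisor (ord z)) → ord (z ^ℕ p d) < ord z
    ord[z^p]<ord d = ¬coprime⇒ord<ord z (p d) (λ coprime → >⇒≢ (prime⇒1< (isPrime d)) (coprime (∣-refl , p∣m d)))

    rootPrime : ∀ {b} → ProperPower z b → Σ (PrimeDivisor (ord z)) λ d → b ∈⟨ z ^ℕ p d ⟩
    rootPrime ((a , refl) , z∉⟨zᵃ⟩) with ¬coprime⇒commonPrime (≢-nonZero⁻¹ (ord z)) (z∉⟨zᵃ⟩ ∘ coprime⇒∈⟨^⟩ z a)
    ... | q , qq , divides a′ a≡a′*q , q∣ord = primeDivisor q qq q∣ord , a′ , (begin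
      (z ^ℕ q) ^ℕ a′  ≡⟨ ^ℕ-* z q a′ ⟨
      z ^ℕ (q * a′)   ≡⟨ cong (z ^ℕ_) (trans (*-comm q a′) (sym a≡a′*q)) ⟩
      z ^ℕ a          ∎)
      where open ≡-Reasoning

    private
      rootPrimes : ∀ {bs} → All (ProperPower z) bs → List (PrimeDivisor (ord z))
      rootPrimes []         = []
      rootPrimes (pb ∷ pbs) = proj₁ (rootPrime pb) ∷ rootPrimes pbs

      length-rootPrimes : ∀ {bs} (pbs : All (ProperPower z) bs) → length (rootPrimes pbs) ≡ length bs
      length-rootPrimes []         = refl
      length-rootPrimes (_ ∷ pbs) = cong suc (length-rootPrimes pbs)

      rootPrime-distinct : ∀ {b b′} (pb : ProperPower z b) (pb′ : ProperPower z b′) →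
                           CommonRootsAtLeast (ord z) b b′ → p (proj₁ (rootPrime pb)) ≢ p (proj₁ (rootPrime pb′))
      rootPrime-distinct pb pb′ far p≡p′ with rootPrime pb | rootPrime pb′
      ... | d , b∈⟨zᵖ⟩ | _ , b′∈⟨zᵖ′⟩ =
        <⇒≱ (ord[z^p]<ord d) (far _ b∈⟨zᵖ⟩ (subst (λ q → _ ∈⟨ z ^ℕ q ⟩) (sym p≡p′) b′∈⟨zᵖ′⟩))

      rootPrimes-distinct : ∀ {bs} (pbs : All (ProperPower z) bs) → AllPairs (CommonRootsAtLeast (ord z)) bs →
                            AllPairs (λ d d′ → p d ≢ p d′) (rootPrimes pbs)
      rootPrimes-distinct []         []           = []
      rootPrimes-distinct (pb ∷ pbs) (far ∷ fars) = distinctFrom pbs far ∷ rootPrimes-distinct pbs fars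
        where
        distinctFrom : ∀ {bs} (pbs : All (ProperPower z) bs) → All (CommonRootsAtLeast (ord z) _) bs →
                       All (λ d′ → p (proj₁ (rootPrime pb)) ≢ p d′) (rootPrimes pbs)
        distinctFrom []          []            = []
        distinctFrom (pb′ ∷ pbs) (far′ ∷ fars) = rootPrime-distinct pb pb′ far′ ∷ distinctFrom pbs fars

      unitPower : PrimeDivisor (ord z) → Elt
      unitPower d = z ^ℕ unit d

      generatorsFromPrimes : ∀ ds → AllPairs (λ d d′ → p d ≢ p d′) ds → 3 ≤ length ds →
                             Unique (map unitPower ds) × All (_generates⟨ z ⟩) (map unitPower ds)
      generatorsFromPrimes ds@(d₁ ∷ d₂ ∷ d₃ ∷ _) distinct@((p₁≢p₂ ∷ p₁≢p₃ ∷ _) ∷ (p₂≢p₃ ∷ _) ∷ _) _ =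
        AllPairs.map⁺ (AllPairs.map (λ {d} {d′} → distinctPowers {d} {d′}) distinct) ,
        All.map⁺ (All.universal generator ds)
        where
        open ThreeDistinctPrimes d₁ d₂ d₃ p₁≢p₂ p₁≢p₃ p₂≢p₃
        generator : ∀ d → unitPower d generates⟨ z ⟩
        generator d = (unit d , refl) , coprime⇒∈⟨^⟩ z (unit d) (unit-coprime d)
        distinctPowers : ∀ {d d′} → p d ≢ p d′ → unitPower d ≢ unitPower d′
        distinctPowers {d} {d′} p≢p′ zᵘ≡zᵘ′ =
          unit-injective d d′ p≢p′ (^ℕ-injective-below-ord z (unit<m d) (unit<m d′) zᵘ≡zᵘ′)
      generatorsFromPrimes []                _ ()
      generatorsFromPrimes (_ ∷ [])          _ (s≤s ())
      generatorsFromPrimes (_ ∷ _ ∷ [])      _ (s≤s (s≤s ()))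

    generatorsFromProperPowers : ∀ {bs} → All (ProperPower z) bs → AllPairs (CommonRootsAtLeast (ord z)) bs →
                                 3 ≤ length bs → ∃ λ gs → Unique gs × All (_generates⟨ z ⟩) gs × length gs ≡ length bs
    generatorsFromProperPowers pbs fars 3≤length
      with generatorsFromPrimes (rootPrimes pbs) (rootPrimes-distinct pbs fars)
                                (subst (3 ≤_) (sym (length-rootPrimes pbs)) 3≤length)
    ... | unique , generators =
      _ , unique , generators , trans (length-map _ (rootPrimes pbs)) (length-rootPrimes pbs)

  -- The power graph and the enhanced power graph

  powerAdj-intro : ∀ {a b} → a ≢ b → b ∈⟨ a ⟩ ⊎ a ∈⟨ b ⟩ → PowerAdj a b
  powerAdj-intro a≢b (inj₁ b∈⟨a⟩) = a≢b , inj₁ (∈⟨⟩⇒IsPowerOf b∈⟨a⟩)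
  powerAdj-intro a≢b (inj₂ a∈⟨b⟩) = a≢b , inj₂ (∈⟨⟩⇒IsPowerOf a∈⟨b⟩)

  powerAdj-elim : ∀ {a b} → PowerAdj a b → b ∈⟨ a ⟩ ⊎ a ∈⟨ b ⟩
  powerAdj-elim (_ , inj₁ b∈⟨a⟩) = inj₁ (IsPowerOf⇒∈⟨⟩ b∈⟨a⟩)
  powerAdj-elim (_ , inj₂ a∈⟨b⟩) = inj₂ (IsPowerOf⇒∈⟨⟩ a∈⟨b⟩)

  powerAdj? : ∀ a b → Dec (PowerAdj a b)
  powerAdj? a b with a Fin.≟ b | b ∈⟨ a ⟩? | a ∈⟨ b ⟩?
  ... | yes refl | _ | _ = no (λ (a≢a , _) → a≢a refl)
  ... | no a≢b | yes b∈⟨a⟩ | _         = yes (powerAdj-intro a≢b (inj₁ b∈⟨a⟩))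
  ... | no a≢b | no _      | yes a∈⟨b⟩ = yes (powerAdj-intro a≢b (inj₂ a∈⟨b⟩))
  ... | no _   | no b∉⟨a⟩ | no a∉⟨b⟩  = no ([ b∉⟨a⟩ , a∉⟨b⟩ ]′ ∘ powerAdj-elim)

  enhancedAdj-intro : ∀ {a b z} → a ≢ b → a ∈⟨ z ⟩ → b ∈⟨ z ⟩ → EnhancedPowerAdj a b
  enhancedAdj-intro a≢b a∈⟨z⟩ b∈⟨z⟩ = a≢b , _ , ∈⟨⟩⇒IsPowerOf a∈⟨z⟩ , ∈⟨⟩⇒IsPowerOf b∈⟨z⟩

  enhancedAdj-root : ∀ {a b} → EnhancedPowerAdj a b → ∃ λ z → a ∈⟨ z ⟩ × b ∈⟨ z ⟩
  enhancedAdj-root (_ , z , a∈⟨z⟩ , b∈⟨z⟩) = z , IsPowerOf⇒∈⟨⟩ a∈⟨z⟩ , IsPowerOf⇒∈⟨⟩ b∈⟨z⟩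

  powerAdj⇒enhancedAdj : ∀ {a b} → PowerAdj a b → EnhancedPowerAdj a b
  powerAdj⇒enhancedAdj {a} {b} adj@(a≢b , _) with powerAdj-elim adj
  ... | inj₁ b∈⟨a⟩ = enhancedAdj-intro a≢b (∈⟨⟩-refl a) b∈⟨a⟩
  ... | inj₂ a∈⟨b⟩ = enhancedAdj-intro a≢b a∈⟨b⟩ (∈⟨⟩-refl b)

  powerAdj-sym : ∀ {a b} → PowerAdj a b → PowerAdj b a
  powerAdj-sym (a≢b , related) = a≢b ∘ sym , Data.Sum.swap related

  generator-powerAdj : ∀ {z b k} → ProperPower z b → k generates⟨ z ⟩ → PowerAdj b k
  generator-powerAdj (b∈⟨z⟩ , z∉⟨b⟩) (_ , z∈⟨k⟩) =
    powerAdj-intro (λ { refl → z∉⟨b⟩ z∈⟨k⟩ }) (inj₂ (∈⟨⟩-trans z∈⟨k⟩ b∈⟨z⟩))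

  opaque
    commonRoot? : ∀ a b u → Dec (a ∈⟨ u ⟩ × b ∈⟨ u ⟩)
    commonRoot? a b u = a ∈⟨ u ⟩? ×-dec b ∈⟨ u ⟩?

    commonRoots : Elt → Elt → List Elt
    commonRoots a b = filter (commonRoot? a b) (allFin order)

    level : Elt → Elt → ℕ
    level a b = min order (map ord (commonRoots a b))

    level≤ord : ∀ {a b u} → a ∈⟨ u ⟩ → b ∈⟨ u ⟩ → level a b ≤ ord u
    level≤ord {a} {b} {u} a∈⟨u⟩ b∈⟨u⟩ =
      min≤v⁺ order _ (inj₂ (Any.map (≤-reflexive ∘ sym)
                                    (∈-map⁺ ord (∈-filter⁺ (commonRoot? a b) (∈-allFin u) (a∈⟨u⟩ , b∈⟨u⟩)))))

    rootOfLevel : ∀ {a b u} → a ∈⟨ u ⟩ → b ∈⟨ u ⟩ → ∃ λ r → (a ∈⟨ r ⟩ × b ∈⟨ r ⟩) × ord r ≡ level a b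
    rootOfLevel {a} {b} {u} a∈⟨u⟩ b∈⟨u⟩ with argmin-sel id order (map ord (commonRoots a b))
    ... | inj₁ level≡order =
      u , (a∈⟨u⟩ , b∈⟨u⟩) , ≤-antisym (≤-trans (ord≤order u) (≤-reflexive (sym level≡order))) (level≤ord a∈⟨u⟩ b∈⟨u⟩)
    ... | inj₂ level∈ with ∈-map⁻ ord level∈
    ...   | r , r∈roots , level≡ord =
      r , proj₂ (∈-filter⁻ (commonRoot? a b) {xs = allFin order} r∈roots) , sym level≡ord

  weight : Elt → Elt → ℕ
  weight a b with powerAdj? a b
  ... | yes _ = 0
  ... | no  _ = 2 ^ level a b

  weight-powerAdj : ∀ {a b} → PowerAdj a b → weight a b ≡ 0
  weight-powerAdj {a} {b} adj with powerAdj? a b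
  ... | yes _    = refl
  ... | no  ¬adj = contradiction adj ¬adj

  weight-¬powerAdj : ∀ {a b} → ¬ PowerAdj a b → weight a b ≡ 2 ^ level a b
  weight-¬powerAdj {a} {b} ¬adj with powerAdj? a b
  ... | yes adj = contradiction adj ¬adj
  ... | no  _   = refl

  weight≤2^level : ∀ a b → weight a b ≤ 2 ^ level a b
  weight≤2^level a b with powerAdj? a b
  ... | yes _ = z≤n
  ... | no  _ = ≤-refl

  potential : List (Elt × Elt) → ℕ
  potential es = sum (map (uncurry weight) es)

  potential-++ : ∀ es fs → potential (es ++ fs) ≡ potential es + potential fs
  potential-++ es fs = trans (cong sum (map-++ (uncurry weight) es fs)) (sum-++ (map (uncurry weight) es) _)

  potential-↭ : ∀ {es fs} → es ↭ fs → potential es ≡ potential fs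
  potential-↭ = sum-↭ ∘ map⁺ (uncurry weight)

  potential-powerEdges : ∀ {ps} → All (Edge PowerAdj) ps → potential ps ≡ 0
  potential-powerEdges []            = refl
  potential-powerEdges (adj ∷ adjs) = cong₂ _+_ (weight-powerAdj adj) (potential-powerEdges adjs)

  Improvement : List (Elt × Elt) → Set
  Improvement es =
    ∃ λ es′ → IsMatching EnhancedPowerAdj es′ × length es′ ≡ length es × potential es′ < potential es

  exchange : ∀ {es} old new rest → es ↭ old ++ rest → IsMatching EnhancedPowerAdj es →
             vertices new ↭ vertices old → (Unique (vertices new) → All (Edge EnhancedPowerAdj) new) →
             length new ≡ length old → potential new < potential old → Improvement es
  exchange {es} old new rest es↭old++rest matching new↭old adjacent length≡ potential< =
    new ++ rest ,
    IsMatching-exchange old new rest (IsMatching-resp-↭ es↭old++rest matching) new↭old adjacent ,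
    (begin-equality
      length (new ++ rest)        ≡⟨ length-++ new ⟩
      length new + length rest    ≡⟨ cong (_+ length rest) length≡ ⟩
      length old + length rest    ≡⟨ length-++ old ⟨
      length (old ++ rest)        ≡⟨ ↭-length es↭old++rest ⟨
      length es                   ∎) ,
    (begin-strict
      potential (new ++ rest)            ≡⟨ potential-++ new rest ⟩
      potential new + potential rest     <⟨ +-monoˡ-< (potential rest) potential< ⟩
      potential old + potential rest     ≡⟨ potential-++ old rest ⟨
      potential (old ++ rest)            ≡⟨ potential-↭ es↭old++rest ⟨
      potential es                       ∎)
    where open ≤-Reasoning

  -- Exchanges around a non-power edge of maximal level

  module MaximalNonPowerEdge {x y rest} (matching : IsMatching EnhancedPowerAdj ((x , y) ∷ rest))
           (x≁y : ¬ PowerAdj x y) (maximal : ∀ {a b} → (a , b) ∈ rest → ¬ PowerAdj a b → level a b ≤ level x y) where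

    m : ℕ
    m = level x y

    private
      adjacentRest : All (Edge EnhancedPowerAdj) rest
      adjacentRest = All.tail (proj₁ matching)

      uniqueRest : Unique (vertices rest)
      uniqueRest with proj₂ matching
      ... | _ ∷ _ ∷ unique = unique

      x≢y : x ≢ y
      x≢y with proj₂ matching
      ... | (x≢y ∷ _) ∷ _ = x≢y

      x∉rest : All (x ≢_) (vertices rest)
      x∉rest with proj₂ matching
      ... | (_ ∷ x∉rest) ∷ _ = x∉rest

      y∉rest : All (y ≢_) (vertices rest)
      y∉rest with proj₂ matching
      ... | _ ∷ y∉rest ∷ _ = y∉rest

      root : ∃ λ z → (x ∈⟨ z ⟩ × y ∈⟨ z ⟩) × ord z ≡ m
      root with enhancedAdj-root (All.head (proj₁ matching))
      ... | u , x∈⟨u⟩ , y∈⟨u⟩ = rootOfLevel x∈⟨u⟩ y∈⟨u⟩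

    z : Elt
    z = proj₁ root

    private
      x∈⟨z⟩ : x ∈⟨ z ⟩
      x∈⟨z⟩ = proj₁ (proj₁ (proj₂ root))

      y∈⟨z⟩ : y ∈⟨ z ⟩
      y∈⟨z⟩ = proj₂ (proj₁ (proj₂ root))

      ord[z]≡m : ord z ≡ m
      ord[z]≡m = proj₂ (proj₂ root)

      x-proper : ProperPower z x
      x-proper = x∈⟨z⟩ , λ z∈⟨x⟩ → x≁y (powerAdj-intro x≢y (inj₁ (∈⟨⟩-trans z∈⟨x⟩ y∈⟨z⟩)))

      y-proper : ProperPower z y
      y-proper = y∈⟨z⟩ , λ z∈⟨y⟩ → x≁y (powerAdj-intro x≢y (inj₂ (∈⟨⟩-trans z∈⟨y⟩ x∈⟨z⟩)))

    Cheap : Elt → Elt → Set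
    Cheap a b = PowerAdj a b ⊎ level a b < m

    cheap? : ∀ a b → Dec (Cheap a b)
    cheap? a b = powerAdj? a b ⊎-dec (level a b <? m)

    ¬cheap⇒far : ∀ {a b} → ¬ Cheap a b → CommonRootsAtLeast (ord z) a b
    ¬cheap⇒far ¬cheap u a∈⟨u⟩ b∈⟨u⟩ =
      ≤-trans (≤-reflexive ord[z]≡m) (≤-trans (≮⇒≥ (¬cheap ∘ inj₂)) (level≤ord a∈⟨u⟩ b∈⟨u⟩))

    potential-cheap∷powerEdges : ∀ {a b ps} → Cheap a b → All (Edge PowerAdj) ps → potential ((a , b) ∷ ps) < 2 ^ m
    potential-cheap∷powerEdges {a} {b} {ps} cheap adjs = subst (_< 2 ^ m) (sym potential≡weight) (weight< cheap)
      where
      potential≡weight : potential ((a , b) ∷ ps) ≡ weight a b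
      potential≡weight = trans (cong (weight a b +_) (potential-powerEdges adjs)) (+-identityʳ _)
      weight< : Cheap a b → weight a b < 2 ^ m
      weight< (inj₁ adj)   = subst (_< 2 ^ m) (sym (weight-powerAdj adj)) (m^n>0 2 m)
      weight< (inj₂ lvl<m) = ≤-<-trans (weight≤2^level a b) (^-monoʳ-< 2 (s≤s (s≤s z≤n)) lvl<m)

    2^m≤potential : ∀ es → 2 ^ m ≤ potential ((x , y) ∷ es)
    2^m≤potential es =
      subst (_≤ potential ((x , y) ∷ es)) (weight-¬powerAdj x≁y) (m≤m+n (weight x y) (potential es))

    addGenerator : ∀ {k} → k generates⟨ z ⟩ → k ∉ vertices rest → Improvement ((x , y) ∷ rest)
    addGenerator {k} generator k∉rest =
      (x , k) ∷ rest , (powerAdj⇒enhancedAdj x~k ∷ adjacentRest , unique) , refl ,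
      +-monoˡ-< (potential rest) weight<
      where
      x~k : PowerAdj x k
      x~k = generator-powerAdj x-proper generator
      unique : Unique (x ∷ k ∷ vertices rest)
      unique = (proj₁ x~k ∷ x∉rest) ∷ All.¬Any⇒All¬ _ k∉rest ∷ uniqueRest
      weight< : weight x k < weight x y
      weight< = subst₂ _<_ (sym (weight-powerAdj x~k)) (sym (weight-¬powerAdj x≁y)) (m^n>0 2 m)

    exchange₁ : ∀ {k w e} → e ∈ rest → Joins k w e → (new : List (Elt × Elt)) →
                vertices new ↭ x ∷ y ∷ k ∷ w ∷ [] → (Unique (vertices new) → All (Edge EnhancedPowerAdj) new) →
                length new ≡ 2 → potential new < 2 ^ m → Improvement ((x , y) ∷ rest)
    exchange₁ {k} {w} {e} e∈rest joins new new↭ adjacent length≡2 potential< with ∈⇒↭∷ e∈rest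
    ... | rest′ , rest↭ =
      exchange ((x , y) ∷ e ∷ []) new rest′ (↭-prep _ rest↭) matching
        (↭-trans new↭ (↭-sym (↭-prep x (↭-prep y (vertices-joins [] joins))))) adjacent length≡2
        (<-≤-trans potential< (2^m≤potential (e ∷ [])))

    exchange₂ : ∀ {k w e k′ w′ e′} → e ∈ rest → Joins k w e → e′ ∈ rest → Joins k′ w′ e′ → e′ ≢ e →
                (new : List (Elt × Elt)) → vertices new ↭ x ∷ y ∷ k ∷ w ∷ k′ ∷ w′ ∷ [] →
                (Unique (vertices new) → All (Edge EnhancedPowerAdj) new) →
                length new ≡ 3 → potential new < 2 ^ m → Improvement ((x , y) ∷ rest)
    exchange₂ {k} {w} {e} {_} {_} {e′} e∈rest joins e′∈rest joins′ e′≢e new new↭ adjacent length≡3 potential<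
      with ∈₂⇒↭∷∷ e∈rest e′∈rest e′≢e
    ... | rest′ , rest↭ =
      exchange ((x , y) ∷ e ∷ e′ ∷ []) new rest′ (↭-prep _ rest↭) matching
        (↭-trans new↭ (↭-sym (↭-prep x (↭-prep y old↭))))
        adjacent length≡3 (<-≤-trans potential< (2^m≤potential (e ∷ e′ ∷ [])))
      where
      old↭ : vertices (e ∷ e′ ∷ []) ↭ k ∷ w ∷ _
      old↭ = ↭-trans (vertices-joins (e′ ∷ []) joins) (↭-prep k (↭-prep w (vertices-joins [] joins′)))

    private
      smallRoot : ∀ {k w e} → e ∈ rest → Joins k w e → ¬ PowerAdj k w →
                  ∃ λ r → (k ∈⟨ r ⟩ × w ∈⟨ r ⟩) × ord r ≤ m
      smallRoot e∈rest (inj₁ refl) ¬adj with enhancedAdj-root (All.lookup adjacentRest e∈rest)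
      ... | u , k∈⟨u⟩ , w∈⟨u⟩ with rootOfLevel k∈⟨u⟩ w∈⟨u⟩
      ...   | r , r-root , ord≡level = r , r-root , ≤-trans (≤-reflexive ord≡level) (maximal e∈rest ¬adj)
      smallRoot e∈rest (inj₂ refl) ¬adj with enhancedAdj-root (All.lookup adjacentRest e∈rest)
      ... | u , w∈⟨u⟩ , k∈⟨u⟩ with rootOfLevel w∈⟨u⟩ k∈⟨u⟩
      ...   | r , (w∈⟨r⟩ , k∈⟨r⟩) , ord≡level =
        r , (k∈⟨r⟩ , w∈⟨r⟩) , ≤-trans (≤-reflexive ord≡level) (maximal e∈rest (¬adj ∘ powerAdj-sym))

    generatorEdge-powers : ∀ {k w e} → k generates⟨ z ⟩ → e ∈ rest → Joins k w e → w ∈⟨ k ⟩ ⊎ k ∈⟨ w ⟩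
    generatorEdge-powers {k} {w} (_ , z∈⟨k⟩) e∈rest joins with powerAdj? k w
    ... | yes adj = powerAdj-elim adj
    ... | no ¬adj with smallRoot e∈rest joins ¬adj
    ...   | r , (k∈⟨r⟩ , w∈⟨r⟩) , ord≤m = inj₁ (∈⟨⟩-trans z∈⟨k⟩ (∈⟨⟩-trans r∈⟨z⟩ w∈⟨r⟩))
      where
      r∈⟨z⟩ : r ∈⟨ z ⟩
      r∈⟨z⟩ = ∈⟨⟩∧ord≤⇒∈⟨⟩ (∈⟨⟩-trans k∈⟨r⟩ z∈⟨k⟩) (≤-trans ord≤m (≤-reflexive (sym ord[z]≡m)))

    record Partner (k : Elt) : Set where
      constructor partner
      field
        w        : Elt
        e        : Elt × Elt
        e∈rest   : e ∈ rest
        joins    : Joins k w e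
        w-proper : ProperPower z w

    classify : ∀ {k} → k generates⟨ z ⟩ → Improvement ((x , y) ∷ rest) ⊎ Partner k
    classify {k} generator with k ∈? vertices rest
    ... | no k∉rest = inj₁ (addGenerator generator k∉rest)
    ... | yes k∈rest with ∈-vertices⇒joins rest k∈rest
    ...   | w , e , e∈rest , joins with k ∈⟨ w ⟩?
    ...     | yes k∈⟨w⟩ = inj₁ (exchange₁ e∈rest joins ((x , k) ∷ (y , w) ∷ []) (↭-prep x (↭-swap k y ↭-refl))
                            (λ _ → powerAdj⇒enhancedAdj x~k ∷ powerAdj⇒enhancedAdj y~w ∷ []) refl
                            (potential-cheap∷powerEdges (inj₁ x~k) (y~w ∷ [])))
      where
      x~k : PowerAdj x k
      x~k = generator-powerAdj x-proper generator
      y~w : PowerAdj y w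
      y~w = powerAdj-intro (All.lookup y∉rest (proj₂ (joins⇒∈-vertices e∈rest joins)))
                           (inj₂ (∈⟨⟩-trans k∈⟨w⟩ (∈⟨⟩-trans (proj₂ generator) y∈⟨z⟩)))
    ...     | no k∉⟨w⟩ = inj₂ (partner w e e∈rest joins (w∈⟨z⟩ , λ z∈⟨w⟩ → k∉⟨w⟩ (∈⟨⟩-trans z∈⟨w⟩ (proj₁ generator))))
      where
      w∈⟨k⟩ : w ∈⟨ k ⟩
      w∈⟨k⟩ = [ id , (λ k∈⟨w⟩ → contradiction k∈⟨w⟩ k∉⟨w⟩) ]′ (generatorEdge-powers generator e∈rest joins)
      w∈⟨z⟩ : w ∈⟨ z ⟩
      w∈⟨z⟩ = ∈⟨⟩-trans (proj₁ generator) w∈⟨k⟩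

    PartneredGenerator : Set
    PartneredGenerator = Σ Elt λ k → k generates⟨ z ⟩ × Partner k

    partnerOf : PartneredGenerator → Elt
    partnerOf (_ , _ , p) = Partner.w p

    classifyAll : ∀ {ks} → All (_generates⟨ z ⟩) ks →
                  Improvement ((x , y) ∷ rest) ⊎ Σ (List PartneredGenerator) (λ qs → map proj₁ qs ≡ ks)
    classifyAll [] = inj₂ ([] , refl)
    classifyAll (generator ∷ generators) with classify generator | classifyAll generators
    ... | inj₁ improvement | _                  = inj₁ improvement
    ... | inj₂ _           | inj₁ improvement   = inj₁ improvement
    ... | inj₂ p           | inj₂ (qs , refl)   = inj₂ ((_ , generator , p) ∷ qs , refl)

    cheapWithX : (q : PartneredGenerator) → Cheap x (partnerOf q) → Improvement ((x , y) ∷ rest)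
    cheapWithX (k , generator , partner w e e∈rest joins w-proper) cheap =
      exchange₁ e∈rest joins ((x , w) ∷ (y , k) ∷ []) (↭-prep x (↭-sym (shift w (y ∷ k ∷ []) [])))
        (λ _ → enhancedAdj-intro x≢w x∈⟨z⟩ (proj₁ w-proper) ∷ powerAdj⇒enhancedAdj y~k ∷ []) refl
        (potential-cheap∷powerEdges cheap (y~k ∷ []))
      where
      y~k = generator-powerAdj y-proper generator
      x≢w = All.lookup x∉rest (proj₂ (joins⇒∈-vertices e∈rest joins))

    cheapWithY : (q : PartneredGenerator) → Cheap y (partnerOf q) → Improvement ((x , y) ∷ rest)
    cheapWithY (k , generator , partner w e e∈rest joins w-proper) cheap =
      exchange₁ e∈rest joins ((y , w) ∷ (x , k) ∷ [])
        (↭-trans (shifts (y ∷ w ∷ []) (x ∷ k ∷ [])) (↭-prep x (↭-swap k y ↭-refl)))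
        (λ _ → enhancedAdj-intro y≢w y∈⟨z⟩ (proj₁ w-proper) ∷ powerAdj⇒enhancedAdj x~k ∷ []) refl
        (potential-cheap∷powerEdges cheap (x~k ∷ []))
      where
      x~k = generator-powerAdj x-proper generator
      y≢w = All.lookup y∉rest (proj₂ (joins⇒∈-vertices e∈rest joins))

    cheapPair : (q q′ : PartneredGenerator) → proj₁ q ≢ proj₁ q′ → Cheap (partnerOf q) (partnerOf q′) →
                Improvement ((x , y) ∷ rest)
    cheapPair (k , generator , partner w e e∈rest joins w-proper) (k′ , generator′ , partner w′ e′ e′∈rest joins′ w′-proper)
              k≢k′ cheap =
      exchange₂ e∈rest joins e′∈rest joins′ (distinctEdges joins joins′) ((w , w′) ∷ (x , k) ∷ (y , k′) ∷ [])
        (↭-trans (shifts (w ∷ w′ ∷ []) (x ∷ k ∷ y ∷ k′ ∷ [])) (↭-prep x (↭-swap k y (↭-swap k′ w ↭-refl))))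
        adjacent refl (potential-cheap∷powerEdges cheap (x~k ∷ y~k′ ∷ []))
      where
      x~k  = generator-powerAdj x-proper generator
      y~k′ = generator-powerAdj y-proper generator′
      distinctEdges : ∀ {e e′} → Joins k w e → Joins k′ w′ e′ → e′ ≢ e
      distinctEdges (inj₁ refl) (inj₁ refl) refl = k≢k′ refl
      distinctEdges (inj₁ refl) (inj₂ refl) refl = proj₂ w′-proper (proj₂ generator)
      distinctEdges (inj₂ refl) (inj₁ refl) refl = proj₂ w-proper (proj₂ generator′)
      distinctEdges (inj₂ refl) (inj₂ refl) refl = k≢k′ refl
      adjacent : Unique (w ∷ w′ ∷ x ∷ k ∷ y ∷ k′ ∷ []) → All (Edge EnhancedPowerAdj) ((w , w′) ∷ (x , k) ∷ (y , k′) ∷ [])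
      adjacent ((w≢w′ ∷ _) ∷ _) =
        enhancedAdj-intro w≢w′ (proj₁ w-proper) (proj₁ w′-proper) ∷ powerAdj⇒enhancedAdj x~k ∷ powerAdj⇒enhancedAdj y~k′ ∷ []

    generators : List Elt
    generators = filter (_generates⟨ z ⟩?) (allFin order)

    ∈-generators : ∀ {k} → k generates⟨ z ⟩ → k ∈ generators
    ∈-generators {k} = ∈-filter⁺ (_generates⟨ z ⟩?) (∈-allFin k)

    private
      farApart⇒⊥ : ∀ qs → map proj₁ qs ≡ generators →
                   All (¬_ ∘ Cheap x ∘ partnerOf) qs → All (¬_ ∘ Cheap y ∘ partnerOf) qs →
                   AllPairs (λ q q′ → ¬ Cheap (partnerOf q) (partnerOf q′)) qs → ⊥
      farApart⇒⊥ qs keys≡generators x-far y-far pairs-far =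
        tooManyGenerators (generatorsFromProperPowers z proper far 3≤length)
        where
        length≡ : length (map partnerOf qs) ≡ length generators
        length≡ = trans (length-map partnerOf qs) (trans (sym (length-map proj₁ qs)) (cong length keys≡generators))
        proper : All (ProperPower z) (x ∷ y ∷ map partnerOf qs)
        proper = x-proper ∷ y-proper ∷ All.map⁺ (All.universal (λ (_ , _ , p) → Partner.w-proper p) qs)
        far : AllPairs (CommonRootsAtLeast (ord z)) (x ∷ y ∷ map partnerOf qs)
        far = (¬cheap⇒far [ x≁y , <-irrefl refl ]′ ∷ All.map⁺ (All.map ¬cheap⇒far x-far))
            ∷ All.map⁺ (All.map ¬cheap⇒far y-far)
            ∷ AllPairs.map⁺ (AllPairs.map ¬cheap⇒far pairs-far)
        3≤length : 3 ≤ length (x ∷ y ∷ map partnerOf qs)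
        3≤length = s≤s (s≤s (subst (0 <_) (sym length≡) (∈⇒length>0 (∈-generators (∈⟨⟩-refl z , ∈⟨⟩-refl z)))))
        tooManyGenerators : (∃ λ gs → Unique gs × All (_generates⟨ z ⟩) gs × length gs ≡ 2 + length (map partnerOf qs)) →
                            ⊥
        tooManyGenerators (gs , unique , gs-generators , length-gs≡) =
          1+n≰n (≤-trans (n≤1+n _) (subst (_≤ length generators) (trans length-gs≡ (cong (2 +_) length≡))
                                           (Unique∧⊆⇒length≤ unique (All.map ∈-generators gs-generators))))

    improvement : Improvement ((x , y) ∷ rest)
    improvement with classifyAll (All.all-filter (_generates⟨ z ⟩?) (allFin order))
    ... | inj₁ better = better
    ... | inj₂ (qs , keys≡generators)
      with All¬⊎∃ (cheap? x ∘ partnerOf) qs | All¬⊎∃ (cheap? y ∘ partnerOf) qs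
         | AllPairs¬⊎∃ (λ q q′ → cheap? (partnerOf q) (partnerOf q′)) distinctKeys
      where
      distinctKeys : AllPairs (λ q q′ → proj₁ q ≢ proj₁ q′) qs
      distinctKeys =
        AllPairs.map⁻ (subst Unique (sym keys≡generators) (Unique.filter⁺ (_generates⟨ z ⟩?) (Unique.allFin⁺ order)))
    ...   | inj₂ (q , _ , cheap) | _                    | _                               = cheapWithX q cheap
    ...   | inj₁ _               | inj₂ (q , _ , cheap) | _                               = cheapWithY q cheap
    ...   | inj₁ _               | inj₁ _               | inj₂ (q , q′ , k≢k′ , cheap)    = cheapPair q q′ k≢k′ cheap
    ...   | inj₁ x-far           | inj₁ y-far           | inj₁ pairs-far =
      ⊥-elim (farApart⇒⊥ qs keys≡generators x-far y-far pairs-far)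

  NonPowerEdge : Elt × Elt → Set
  NonPowerEdge (a , b) = ¬ PowerAdj a b

  nonPowerEdge? : ∀ e → Dec (NonPowerEdge e)
  nonPowerEdge? (a , b) = ¬? (powerAdj? a b)

  IsMaximalNonPowerEdge : List (Elt × Elt) → Elt × Elt → Set
  IsMaximalNonPowerEdge es e =
    (e ∈ es × NonPowerEdge e) × (∀ {e′} → e′ ∈ es → NonPowerEdge e′ → uncurry level e′ ≤ uncurry level e)

  maximalNonPowerEdge : ∀ {es e₀} → e₀ ∈ es → NonPowerEdge e₀ → ∃ (IsMaximalNonPowerEdge es)
  maximalNonPowerEdge {es} {e₀} e₀∈es e₀-nonPower =
    argmax (uncurry level) e₀ nonPowerEdges ,
    argmax-all (uncurry level) (e₀∈es , e₀-nonPower) (All.tabulate (∈-filter⁻ nonPowerEdge?)) ,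
    λ e′∈es e′-nonPower →
      All.lookup (f[xs]≤f[argmax] e₀ nonPowerEdges) (∈-filter⁺ nonPowerEdge? e′∈es e′-nonPower)
    where
    nonPowerEdges = filter nonPowerEdge? es

  Improvement-resp-↭ : ∀ {es fs} → es ↭ fs → Improvement fs → Improvement es
  Improvement-resp-↭ es↭fs (es′ , matching , length≡ , potential<) =
    es′ , matching , trans length≡ (sym (↭-length es↭fs)) ,
    subst (potential es′ <_) (sym (potential-↭ es↭fs)) potential<

  improve : ∀ {es e₀} → IsMatching EnhancedPowerAdj es → e₀ ∈ es → NonPowerEdge e₀ → Improvement es
  improve {es} matching e₀∈es e₀-nonPower = improveAt (maximalNonPowerEdge e₀∈es e₀-nonPower)
    where
    improveAt : ∃ (IsMaximalNonPowerEdge es) → Improvement es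
    improveAt ((x , y) , (xy∈es , x≁y) , maximal) =
      let rest , es↭ = ∈⇒↭∷ xy∈es in
      Improvement-resp-↭ es↭ (MaximalNonPowerEdge.improvement (IsMatching-resp-↭ es↭ matching) x≁y
                               (λ ab∈rest → maximal (∈-resp-↭ (↭-sym es↭) (there ab∈rest))))

  enhancedMatching⇒powerMatching : ∀ {es} → IsMatching EnhancedPowerAdj es → MatchingOfSize PowerAdj (length es)
  enhancedMatching⇒powerMatching {es} matching = go matching (<-wellFounded (potential es))
    where
    go : ∀ {es} → IsMatching EnhancedPowerAdj es → Acc _<_ (potential es) → MatchingOfSize PowerAdj (length es)
    go {es} matching@(_ , unique) (acc rec) = [ powerEdges⇒done , improveAndRecurse ]′ (All¬⊎∃ nonPowerEdge? es)
      where
      powerEdges⇒done : All (¬_ ∘ NonPowerEdge) es → MatchingOfSize PowerAdj (length es)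
      powerEdges⇒done powerEdges =
        es , (All.map (λ {(a , b)} → decidable-stable (powerAdj? a b)) powerEdges , unique) , refl
      recurse : Improvement es → MatchingOfSize PowerAdj (length es)
      recurse (es′ , matching′ , length≡ , potential<) =
        map₂ (map₂ (λ length≡′ → trans length≡′ length≡)) (go matching′ (rec potential<))
      improveAndRecurse : (∃ λ e₀ → e₀ ∈ es × NonPowerEdge e₀) → MatchingOfSize PowerAdj (length es)
      improveAndRecurse (_ , e₀∈es , e₀-nonPower) = recurse (improve matching e₀∈es e₀-nonPower)

mainTheorem16 : (G : FiniteGroup) → (m : ℕ) →
    (IsMatchingNumber (FiniteGroup.PowerAdj G) m → IsMatchingNumber (FiniteGroup.EnhancedPowerAdj G) m)
    × (IsMatchingNumber (FiniteGroup.EnhancedPowerAdj G) m → IsMatchingNumber (FiniteGroup.PowerAdj G) m)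
mainTheorem16 G = sameMatchingNumber (powerAdj⇒enhancedAdj G) (enhancedMatching⇒powerMatching G)
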